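{- For every finite set of assumptions $\Gamma$ and all session contracts $\rho,\sigma$: if $\mathrm{Synth}(\Gamma,\rho,\sigma)=\mathcal F\neq\emptyset$, then for every $f\in\mathcal F$ the judgement $\Gamma\vdash f:\rho\asymp\sigma$ is derivable in the inference system described in the context.
   Context: Names and actions. Fix a countable set $\mathcal N$ of names; $\overline{\mathcal N}=\{\overline a\mid a\in\mathcal N\}$, $\mathrm{Act}=\mathcal N\cup\overline{\mathcal N}$, $\overline{\overline a}=a$. Session contracts: closed terms of $\sigma::=\mathbf 1\mid a_1.\sigma_1+\cdots+a_n.\sigma_n\mid\overline a_1.\sigma_1\oplus\cdots\oplus\overline a_n.\sigma_n\mid x\mid\mathrm{rec}\,x.\sigma$ ($n\ge1$, $a_i\in\mathcal N$), with the $a_i$ (resp. $\overline a_i$) pairwise distinct in each external (resp. internal) choice, body of $\mathrm{rec}$ not a variable; recursion is equi-recursive ($\mathrm{rec}\,x.\sigma=\sigma\{\mathrm{rec}\,x.\sigma/x\}$) and choices are modulo commutativity. Orchestration actions: $\iota_L::=\langle a,\varepsilon\rangle\mid\langle a,\overline a\rangle$, $\iota_R::=\langle\varepsilon,a\rangle\mid\langle\overline a,a\rangle$, $o::=\langle\overline a,\varepsilon\rangle\mid\langle\varepsilon,\overline a\rangle$ ($a\in\mathcal N$). Orchestrator terms: $f::=\mathbf 1\mid\iota_L.f_1\vee\cdots\vee\iota_L.f_n\mid\iota_R.f_1\vee\cdots\vee\iota_R.f_n\mid o.f\mid x\mid\mathrm{rec}\,x.f$ ($n\ge1$, body of $\mathrm{rec}$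 not a variable), equi-recursive. Inference system. Judgements $\Gamma\vdash f:\rho\asymp\sigma$ with $\rho,\sigma$ session contracts, $f$ a possibly open orchestrator term, $\Gamma$ a finite set of assumptions $x:\rho_i\asymp\sigma_i$ with each pair assigned at most one variable; in rules introducing $\mathrm{rec}\,x$, $x$ is not declared in $\Gamma$. Rules: (Ax) $\Gamma\vdash\mathbf 1:\mathbf 1\asymp\sigma$. (Hyp) $\Gamma,x:\rho\asymp\sigma\vdash x:\rho\asymp\sigma$. (SumL) for $p\in I$: from $\Gamma,x:\sum_{i\in I}a_i.\rho_i\asymp\sigma\vdash f':\rho_p\asymp\sigma$ infer $\Gamma\vdash\mathrm{rec}\,x.\langle\overline a_p,\varepsilon\rangle.f':\sum_{i\in I}a_i.\rho_i\asymp\sigma$. (SumR) for $p\in I$: from $\Gamma,x:\rho\asymp\sum_{i\in I}a_i.\sigma_i\vdash f':\rho\asymp\sigma_p$ infer $\Gamma\vdash\mathrm{rec}\,x.\langle\varepsilon,\overline a_p\rangle.f':\rho\asymp\sum_{i\in I}a_i.\sigma_i$. With $\rho^\oplus=\bigoplus_{i\in I}\overline a_i.\rho_i$, $\sigma^\oplus=\bigoplus_{j\in J}\overline b_j.\sigma_j$: (OOA) from $\Gamma,x:\rho^\oplus\asymp\sigma^\oplus\vdash f_j:\rho^\oplus\asymp\sigma_j$ ($\forall j\in J$) infer $\Gamma\vdash\mathrm{rec}\,x.\bigvee_{j\in J}\langle\varepsilon,b_j\rangle.f_j:\rho^\oplus\asymp\sigma^\oplus$; (OOB) from $\Gamma,x:\rho^\oplus\asymp\sigma^\oplus\vdash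 f_i:\rho_i\asymp\sigma^\oplus$ ($\forall i\in I$) infer $\Gamma\vdash\mathrm{rec}\,x.\bigvee_{i\in I}\langle a_i,\varepsilon\rangle.f_i:\rho^\oplus\asymp\sigma^\oplus$. (OSum) for $\rho=\bigoplus_{i\in I}\overline a_i.\rho_i$, $\sigma=\sum_{j\in J}a_j.\sigma_j$, $\Gamma'=\Gamma,x:\rho\asymp\sigma$, $I=H\cup K$, $K\subseteq J$: from $\Gamma'\vdash f_i:\rho_i\asymp\sigma$ ($i\in H$) and $\Gamma'\vdash f_i:\rho_i\asymp\sigma_i$ ($i\in K$) infer $\Gamma\vdash\mathrm{rec}\,x.(\bigvee_{h\in H}\langle a_h,\varepsilon\rangle.f_h)\vee(\bigvee_{k\in K}\langle a_k,\overline a_k\rangle.f_k):\rho\asymp\sigma$. (SumO) for $\rho=\sum_{i\in I}a_i.\rho_i$, $\sigma=\bigoplus_{j\in J}\overline a_j.\sigma_j$, $\Gamma'=\Gamma,x:\rho\asymp\sigma$, $J=H\cup K$, $K\subseteq I$: from $\Gamma'\vdash f_j:\rho\asymp\sigma_j$ ($j\in H$) and $\Gamma'\vdash f_j:\rho_j\asymp\sigma_j$ ($j\in K$) infer $\Gamma\vdash\mathrm{rec}\,x.(\bigvee_{h\in H}\langle\varepsilon,a_h\rangle.f_h)\vee(\bigvee_{k\in K}\langle\overline a_k,a_k\rangle.f_k):\rho\asymp\sigma$. The algorithm $\mathrm{Synth}(\Gamma,\rho,\sigma)$, returning a set of orchestrator terms: 1. If $x:\rho\asymp\sigma\in\Gamma$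 for some $x$, return $\{x\}$. 2. Else if $\rho=\mathbf 1$, return $\{\mathbf 1\}$. 3. Otherwise let $\Gamma'=\Gamma,x:\rho\asymp\sigma$ with $x$ a fresh variable, and: (a) if $\rho=\sum_{i\in I}a_i.\rho_i$ and $\sigma=\sum_{j\in J}a_j.\sigma_j$: return $\{\mathrm{rec}\,x.\langle\overline a_i,\varepsilon\rangle.f\mid i\in I,f\in\mathrm{Synth}(\Gamma',\rho_i,\sigma)\}\cup\{\mathrm{rec}\,x.\langle\varepsilon,\overline a_j\rangle.f\mid j\in J,f\in\mathrm{Synth}(\Gamma',\rho,\sigma_j)\}$; (b) if $\rho=\bigoplus_{i\in I}\overline a_i.\rho_i$ and $\sigma=\bigoplus_{j\in J}\overline a_j.\sigma_j$: return $\{\mathrm{rec}\,x.\bigvee_{i\in I}\langle a_i,\varepsilon\rangle.f_i\mid f_i\in\mathrm{Synth}(\Gamma',\rho_i,\sigma)\ \forall i\}\cup\{\mathrm{rec}\,x.\bigvee_{j\in J}\langle\varepsilon,a_j\rangle.f_j\mid f_j\in\mathrm{Synth}(\Gamma',\rho,\sigma_j)\ \forall j\}$; (c) if $\rho=\bigoplus_{i\in I}\overline a_i.\rho_i$ and $\sigma=\sum_{j\in J}a_j.\sigma_j$: return $\{\mathrm{rec}\,x.(\bigvee_{h\in H}\langle a_h,\varepsilon\rangle.f_h)\vee(\bigvee_{k\in K}\langle a_k,\overline a_k\rangle.f_k)\mid I=H\cup K,K\subseteq J,f_h\in\mathrm{Synth}(\Gamma',\rho_h,\sigma),f_k\in\mathrm{Synth}(\Gamma',\rho_k,\sigma_k)\}\cup\{\mathrm{rec}\,x.\langle\varepsilon,\overline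 a_j\rangle.f\mid j\in J,f\in\mathrm{Synth}(\Gamma',\rho,\sigma_j)\}$; (d) if $\rho=\sum_{i\in I}a_i.\rho_i$ and $\sigma=\bigoplus_{j\in J}\overline a_j.\sigma_j$: return $\{\mathrm{rec}\,x.(\bigvee_{h\in H}\langle\varepsilon,a_h\rangle.f_h)\vee(\bigvee_{k\in K}\langle\overline a_k,a_k\rangle.f_k)\mid J=H\cup K,K\subseteq I,f_h\in\mathrm{Synth}(\Gamma',\rho,\sigma_h),f_k\in\mathrm{Synth}(\Gamma',\rho_k,\sigma_k)\}\cup\{\mathrm{rec}\,x.\langle\overline a_i,\varepsilon\rangle.f\mid i\in I,f\in\mathrm{Synth}(\Gamma',\rho_i,\sigma)\}$; (e) otherwise return $\emptyset$. -}

module Defs where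

open import Data.Nat using (ℕ; _≟_)
open import Data.Product using (Σ; ∃; ∃-syntax; _×_; _,_; proj₁; proj₂)
open import Data.Sum using (_⊎_)
open import Data.List using (List; []; _∷_; _++_; map)
open import Data.List.Membership.Propositional using (_∈_)
open import Data.List.Relation.Unary.All using (All)
open import Data.List.Relation.Unary.Any using (Any)
open import Data.List.Relation.Unary.AllPairs using (AllPairs)
open import Data.List.Relation.Unary.Unique.Propositional using (Unique)
open import Data.List.Relation.Binary.Pointwise using (Pointwise)
open import Data.Unit using (⊤)
open import Data.Empty using (⊥)
open import Relation.Nullary using (¬_; yes; no)
open import Relation.Binary.PropositionalEquality using (_≡_; _≢_)

Name : Set
Name = ℕ

CVar : Set
CVar = ℕ

-- A branch a.σ of an external choice, or ā.σ of an internal choice,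
-- is stored as the pair (a , σ).
data Contract : Set where
  𝟏   : Contract
  ext : List (Name × Contract) → Contract   -- a₁.σ₁ + ⋯ + aₙ.σₙ
  int : List (Name × Contract) → Contract   -- ā₁.σ₁ ⊕ ⋯ ⊕ āₙ.σₙ
  var : CVar → Contract
  rec : CVar → Contract → Contract

-- substitution σ{τ/x} (used only with τ closed, so no capture)
mutual
  csub : CVar → Contract → Contract → Contract
  csub x τ 𝟏 = 𝟏
  csub x τ (ext bs) = ext (csubBr x τ bs)
  csub x τ (int bs) = int (csubBr x τ bs)
  csub x τ (var y) with x ≟ y
  ... | yes _ = τ
  ... | no _ = var y
  csub x τ (rec y b) with x ≟ y
  ... | yes _ = rec y b
  ... | no _ = rec y (csub x τ b)

  csubBr : CVar → Contract → List (Name × Contract) → List (Name × Contract)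
  csubBr x τ [] = []
  csubBr x τ ((a , σ) ∷ bs) = (a , csub x τ σ) ∷ csubBr x τ bs

data Free (x : CVar) : Contract → Set where
  fvar : Free x (var x)
  fext : ∀ {bs} → Any (λ b → Free x (proj₂ b)) bs → Free x (ext bs)
  fint : ∀ {bs} → Any (λ b → Free x (proj₂ b)) bs → Free x (int bs)
  frec : ∀ {y b} → x ≢ y → Free x b → Free x (rec y b)

Closed : Contract → Set
Closed σ = ∀ x → ¬ Free x σ

IsVar : Contract → Set
IsVar (var _) = ⊤
IsVar _ = ⊥

data WF : Contract → Set where
  wf𝟏   : WF 𝟏
  wfext : ∀ {bs} → bs ≢ [] → Unique (map proj₁ bs) →
          All (λ b → WF (proj₂ b)) bs → WF (ext bs)
  wfint : ∀ {bs} → bs ≢ [] → Unique (map proj₁ bs) →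
          All (λ b → WF (proj₂ b)) bs → WF (int bs)
  wfvar : ∀ {x} → WF (var x)
  wfrec : ∀ {x b} → ¬ IsVar b → WF b → WF (rec x b)

SessionContract : Contract → Set
SessionContract σ = Closed σ × WF σ

data Unf : Contract → Contract → Set where
  u𝟏   : Unf 𝟏 𝟏
  uext : ∀ {bs} → Unf (ext bs) (ext bs)
  uint : ∀ {bs} → Unf (int bs) (int bs)
  urec : ∀ {x b h} → Unf (csub x (rec x b) b) h → Unf (rec x b) h

-- equality of contracts: equi-recursive (bisimilarity of unfoldings),
-- choices modulo commutativity
mutual
  record _≈_ (ρ σ : Contract) : Set where
    coinductive
    field
      unfold : ∃[ ρ' ] ∃[ σ' ] (Unf ρ ρ' × Unf σ σ' × HeadEq ρ' σ')

  HeadEq : Contract → Contract → Set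
  HeadEq 𝟏 𝟏 = ⊤
  HeadEq (ext bs) (ext cs) = BrEq bs cs
  HeadEq (int bs) (int cs) = BrEq bs cs
  HeadEq _ _ = ⊥

  BrEq : List (Name × Contract) → List (Name × Contract) → Set
  BrEq bs cs =
    (∀ {a ρ} → (a , ρ) ∈ bs → ∃[ σ ] ((a , σ) ∈ cs × ρ ≈ σ)) ×
    (∀ {a σ} → (a , σ) ∈ cs → ∃[ ρ ] ((a , ρ) ∈ bs × ρ ≈ σ))

OVar : Set
OVar = ℕ

data OAct : Set where
  inL   : Name → OAct   -- ⟨a,ε⟩      (ι_L)
  syncL : Name → OAct   -- ⟨a,ā⟩      (ι_L)
  inR   : Name → OAct   -- ⟨ε,a⟩      (ι_R)
  syncR : Name → OAct   -- ⟨ā,a⟩      (ι_R)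
  outL  : Name → OAct   -- ⟨ā,ε⟩      (o)
  outR  : Name → OAct   -- ⟨ε,ā⟩      (o)

data Orch : Set where
  𝟏   : Orch
  ⋁   : List (OAct × Orch) → Orch     -- ι.f₁ ∨ ⋯ ∨ ι.fₙ
  _·_ : OAct → Orch → Orch
  var : OVar → Orch
  rec : OVar → Orch → Orch

Assm : Set
Assm = OVar × Contract × Contract     -- x : ρ ≍ σ

Ctx : Set
Ctx = List Assm

Declared : OVar → Ctx → Set
Declared x Γ = Any (λ e → proj₁ e ≡ x) Γ

_∶_≍_∈_ : OVar → Contract → Contract → Ctx → Set
x ∶ ρ ≍ σ ∈ Γ = Any (λ e → proj₁ e ≡ x × proj₁ (proj₂ e) ≈ ρ × proj₂ (proj₂ e) ≈ σ) Γ

PairIn : Contract → Contract → Ctx → Set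
PairIn ρ σ Γ = ∃[ x ] (x ∶ ρ ≍ σ ∈ Γ)

SamePair : Assm → Assm → Set
SamePair (_ , ρ , σ) (_ , ρ' , σ') = ρ ≈ ρ' × σ ≈ σ'

WfCtx : Ctx → Set
WfCtx Γ = All (λ e → SessionContract (proj₁ (proj₂ e)) × SessionContract (proj₂ (proj₂ e))) Γ
        × Unique (map proj₁ Γ)
        × AllPairs (λ e e' → ¬ SamePair e e') Γ

-- side condition of rules introducing rec x with new assumption x : ρ ≍ σ:
-- x not declared in Γ, and Γ , x : ρ ≍ σ still assigns each pair at most one variable
NewAssm : Ctx → OVar → Contract → Contract → Set
NewAssm Γ x ρ σ = ¬ Declared x Γ × ¬ PairIn ρ σ Γ

infix 4 _⊢_∶_≍_

data _⊢_∶_≍_ : Ctx → Orch → Contract → Contract → Set where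

  Ax  : ∀ {Γ ρ σ} → Unf ρ 𝟏 → Γ ⊢ 𝟏 ∶ ρ ≍ σ

  Hyp : ∀ {Γ x ρ σ} → x ∶ ρ ≍ σ ∈ Γ → Γ ⊢ var x ∶ ρ ≍ σ

  SumL : ∀ {Γ x ρ σ bs a ρp f} → NewAssm Γ x ρ σ →
         Unf ρ (ext bs) → (a , ρp) ∈ bs →
         ((x , ρ , σ) ∷ Γ) ⊢ f ∶ ρp ≍ σ →
         Γ ⊢ rec x (outL a · f) ∶ ρ ≍ σ

  SumR : ∀ {Γ x ρ σ cs a σp f} → NewAssm Γ x ρ σ →
         Unf σ (ext cs) → (a , σp) ∈ cs →
         ((x , ρ , σ) ∷ Γ) ⊢ f ∶ ρ ≍ σp →
         Γ ⊢ rec x (outR a · f) ∶ ρ ≍ σ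

  OOA : ∀ {Γ x ρ σ bs cs ds} → NewAssm Γ x ρ σ →
        Unf ρ (int bs) → Unf σ (int cs) →
        Pointwise (λ c d → proj₁ d ≡ inR (proj₁ c) ×
                           ((x , ρ , σ) ∷ Γ) ⊢ proj₂ d ∶ ρ ≍ proj₂ c) cs ds →
        Γ ⊢ rec x (⋁ ds) ∶ ρ ≍ σ

  OOB : ∀ {Γ x ρ σ bs cs ds} → NewAssm Γ x ρ σ →
        Unf ρ (int bs) → Unf σ (int cs) →
        Pointwise (λ b d → proj₁ d ≡ inL (proj₁ b) ×
                           ((x , ρ , σ) ∷ Γ) ⊢ proj₂ d ∶ proj₂ b ≍ σ) bs ds →
        Γ ⊢ rec x (⋁ ds) ∶ ρ ≍ σ

  -- hs = the H-part ⋁_{h∈H} ⟨a_h,ε⟩.f_h,  ks = the K-part ⋁_{k∈K} ⟨a_k,ā_k⟩.f_k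
  OSum : ∀ {Γ x ρ σ bs cs hs ks} → NewAssm Γ x ρ σ →
         Unf ρ (int bs) → Unf σ (ext cs) →
         All (λ d → ∃[ a ] ∃[ ρa ] (proj₁ d ≡ inL a × (a , ρa) ∈ bs ×
                     ((x , ρ , σ) ∷ Γ) ⊢ proj₂ d ∶ ρa ≍ σ)) hs →
         All (λ d → ∃[ a ] ∃[ ρa ] ∃[ σa ] (proj₁ d ≡ syncL a × (a , ρa) ∈ bs ×
                     (a , σa) ∈ cs × ((x , ρ , σ) ∷ Γ) ⊢ proj₂ d ∶ ρa ≍ σa)) ks →
         Unique (map proj₁ hs) → Unique (map proj₁ ks) →
         All (λ b → inL (proj₁ b) ∈ map proj₁ hs ⊎ syncL (proj₁ b) ∈ map proj₁ ks) bs →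
         Γ ⊢ rec x (⋁ (hs ++ ks)) ∶ ρ ≍ σ

  -- hs = ⋁_{h∈H} ⟨ε,a_h⟩.f_h,  ks = ⋁_{k∈K} ⟨ā_k,a_k⟩.f_k
  SumO : ∀ {Γ x ρ σ bs cs hs ks} → NewAssm Γ x ρ σ →
         Unf ρ (ext bs) → Unf σ (int cs) →
         All (λ d → ∃[ a ] ∃[ σa ] (proj₁ d ≡ inR a × (a , σa) ∈ cs ×
                     ((x , ρ , σ) ∷ Γ) ⊢ proj₂ d ∶ ρ ≍ σa)) hs →
         All (λ d → ∃[ a ] ∃[ ρa ] ∃[ σa ] (proj₁ d ≡ syncR a × (a , ρa) ∈ bs ×
                     (a , σa) ∈ cs × ((x , ρ , σ) ∷ Γ) ⊢ proj₂ d ∶ ρa ≍ σa)) ks →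
         Unique (map proj₁ hs) → Unique (map proj₁ ks) →
         All (λ c → inR (proj₁ c) ∈ map proj₁ hs ⊎ syncR (proj₁ c) ∈ map proj₁ ks) cs →
         Γ ⊢ rec x (⋁ (hs ++ ks)) ∶ ρ ≍ σ

-- The algorithm Synth, as its membership relation:
-- Synth Γ ρ σ f  iff  f ∈ Synth(Γ, ρ, σ)

Step3 : Ctx → OVar → Contract → Contract → Set
Step3 Γ x ρ σ = ¬ PairIn ρ σ Γ × ¬ Declared x Γ

data Synth : Ctx → Contract → Contract → Orch → Set where

  s1 : ∀ {Γ x ρ σ} → x ∶ ρ ≍ σ ∈ Γ → Synth Γ ρ σ (var x)

  s2 : ∀ {Γ ρ σ} → ¬ PairIn ρ σ Γ → Unf ρ 𝟏 → Synth Γ ρ σ 𝟏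

  s3a-L : ∀ {Γ x ρ σ bs cs a ρi f} → Step3 Γ x ρ σ →
          Unf ρ (ext bs) → Unf σ (ext cs) → (a , ρi) ∈ bs →
          Synth ((x , ρ , σ) ∷ Γ) ρi σ f →
          Synth Γ ρ σ (rec x (outL a · f))
  s3a-R : ∀ {Γ x ρ σ bs cs a σj f} → Step3 Γ x ρ σ →
          Unf ρ (ext bs) → Unf σ (ext cs) → (a , σj) ∈ cs →
          Synth ((x , ρ , σ) ∷ Γ) ρ σj f →
          Synth Γ ρ σ (rec x (outR a · f))

  s3b-L : ∀ {Γ x ρ σ bs cs ds} → Step3 Γ x ρ σ →
          Unf ρ (int bs) → Unf σ (int cs) →
          Pointwise (λ b d → proj₁ d ≡ inL (proj₁ b) ×
                             Synth ((x , ρ , σ) ∷ Γ) (proj₂ b) σ (proj₂ d)) bs ds →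
          Synth Γ ρ σ (rec x (⋁ ds))
  s3b-R : ∀ {Γ x ρ σ bs cs ds} → Step3 Γ x ρ σ →
          Unf ρ (int bs) → Unf σ (int cs) →
          Pointwise (λ c d → proj₁ d ≡ inR (proj₁ c) ×
                             Synth ((x , ρ , σ) ∷ Γ) ρ (proj₂ c) (proj₂ d)) cs ds →
          Synth Γ ρ σ (rec x (⋁ ds))

  s3c-HK : ∀ {Γ x ρ σ bs cs hs ks} → Step3 Γ x ρ σ →
           Unf ρ (int bs) → Unf σ (ext cs) →
           All (λ d → ∃[ a ] ∃[ ρa ] (proj₁ d ≡ inL a × (a , ρa) ∈ bs ×
                       Synth ((x , ρ , σ) ∷ Γ) ρa σ (proj₂ d))) hs →
           All (λ d → ∃[ a ] ∃[ ρa ] ∃[ σa ] (proj₁ d ≡ syncL a × (a , ρa) ∈ bs ×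
                       (a , σa) ∈ cs × Synth ((x , ρ , σ) ∷ Γ) ρa σa (proj₂ d))) ks →
           Unique (map proj₁ hs) → Unique (map proj₁ ks) →
           All (λ b → inL (proj₁ b) ∈ map proj₁ hs ⊎ syncL (proj₁ b) ∈ map proj₁ ks) bs →
           Synth Γ ρ σ (rec x (⋁ (hs ++ ks)))
  s3c-R : ∀ {Γ x ρ σ bs cs a σj f} → Step3 Γ x ρ σ →
          Unf ρ (int bs) → Unf σ (ext cs) → (a , σj) ∈ cs →
          Synth ((x , ρ , σ) ∷ Γ) ρ σj f →
          Synth Γ ρ σ (rec x (outR a · f))

  s3d-HK : ∀ {Γ x ρ σ bs cs hs ks} → Step3 Γ x ρ σ →
           Unf ρ (ext bs) → Unf σ (int cs) →
           All (λ d → ∃[ a ] ∃[ σa ] (proj₁ d ≡ inR a × (a , σa) ∈ cs ×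
                       Synth ((x , ρ , σ) ∷ Γ) ρ σa (proj₂ d))) hs →
           All (λ d → ∃[ a ] ∃[ ρa ] ∃[ σa ] (proj₁ d ≡ syncR a × (a , ρa) ∈ bs ×
                       (a , σa) ∈ cs × Synth ((x , ρ , σ) ∷ Γ) ρa σa (proj₂ d))) ks →
           Unique (map proj₁ hs) → Unique (map proj₁ ks) →
           All (λ c → inR (proj₁ c) ∈ map proj₁ hs ⊎ syncR (proj₁ c) ∈ map proj₁ ks) cs →
           Synth Γ ρ σ (rec x (⋁ (hs ++ ks)))
  s3d-L : ∀ {Γ x ρ σ bs cs a ρi f} → Step3 Γ x ρ σ →
          Unf ρ (ext bs) → Unf σ (int cs) → (a , ρi) ∈ bs →
          Synth ((x , ρ , σ) ∷ Γ) ρi σ f →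
          Synth Γ ρ σ (rec x (outL a · f))
  -- 3(e): no constructor

module Submission where

-- Each clause of Synth mirrors one rule of the inference system: step 1 is
-- (Hyp), step 2 is (Ax), step 3(a) and the single-output halves of 3(c)/3(d)
-- are (SumL)/(SumR), step 3(b) is (OOB)/(OOA), and the H/K halves of 3(c)/3(d)
-- are (OSum)/(SumO).  The guard of step 3 (the pair (ρ,σ) has no assumption
-- and x is fresh) is exactly the side condition NewAssm of those rules.

open import Defs
open import Data.Product using (∃-syntax; _×_; _,_; proj₁; proj₂)
open import Data.List.Membership.Propositional using (_∈_)
open import Data.List.Relation.Unary.All using (All; []; _∷_)
open import Data.List.Relation.Binary.Pointwise using (Pointwise; []; _∷_)
open import Relation.Binary.PropositionalEquality using (_≡_)

step3⇒newAssm : ∀ {Γ x ρ σ} → Step3 Γ x ρ σ → NewAssm Γ x ρ σ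
step3⇒newAssm (noPair , fresh) = fresh , noPair

mutual
  synth-sound : ∀ {Γ ρ σ f} → Synth Γ ρ σ f → Γ ⊢ f ∶ ρ ≍ σ
  synth-sound (s1 assumed)        = Hyp assumed
  synth-sound (s2 _ unf)          = Ax unf
  synth-sound (s3a-L g uρ _ br s) = SumL (step3⇒newAssm g) uρ br (synth-sound s)
  synth-sound (s3a-R g _ uσ br s) = SumR (step3⇒newAssm g) uσ br (synth-sound s)
  synth-sound (s3b-L g uρ uσ ds)  = OOB (step3⇒newAssm g) uρ uσ (pointwise-sound ds)
  synth-sound (s3b-R g uρ uσ ds)  = OOA (step3⇒newAssm g) uρ uσ (pointwise-sound ds)
  synth-sound (s3c-HK g uρ uσ hs ks uh uk cover) =
    OSum (step3⇒newAssm g) uρ uσ (hpart-sound hs) (kpart-sound ks) uh uk cover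
  synth-sound (s3c-R g _ uσ br s) = SumR (step3⇒newAssm g) uσ br (synth-sound s)
  synth-sound (s3d-HK g uρ uσ hs ks uh uk cover) =
    SumO (step3⇒newAssm g) uρ uσ (hpart-sound hs) (kpart-sound ks) uh uk cover
  synth-sound (s3d-L g uρ _ br s) = SumL (step3⇒newAssm g) uρ br (synth-sound s)

  pointwise-sound :
    ∀ {A : Set} {Δ bs ds} {Label : A → OAct × Orch → Set} {left right : A → Contract} →
    Pointwise (λ b d → Label b d × Synth Δ (left b) (right b) (proj₂ d)) bs ds →
    Pointwise (λ b d → Label b d × Δ ⊢ proj₂ d ∶ left b ≍ right b) bs ds
  pointwise-sound []             = []
  pointwise-sound ((l , s) ∷ ds) = (l , synth-sound s) ∷ pointwise-sound ds

  hpart-sound :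
    ∀ {Δ bs hs} {ι : Name → OAct} {left right : Contract → Contract} →
    All (λ d → ∃[ a ] ∃[ τ ] (proj₁ d ≡ ι a × (a , τ) ∈ bs ×
                               Synth Δ (left τ) (right τ) (proj₂ d))) hs →
    All (λ d → ∃[ a ] ∃[ τ ] (proj₁ d ≡ ι a × (a , τ) ∈ bs ×
                               Δ ⊢ proj₂ d ∶ left τ ≍ right τ)) hs
  hpart-sound [] = []
  hpart-sound ((a , τ , act , br , s) ∷ hs) =
    (a , τ , act , br , synth-sound s) ∷ hpart-sound hs

  kpart-sound :
    ∀ {Δ bs cs ks} {Label : OAct → Name → Set} →
    All (λ d → ∃[ a ] ∃[ ρa ] ∃[ σa ] (Label (proj₁ d) a × (a , ρa) ∈ bs ×
                     (a , σa) ∈ cs × Synth Δ ρa σa (proj₂ d))) ks →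
    All (λ d → ∃[ a ] ∃[ ρa ] ∃[ σa ] (Label (proj₁ d) a × (a , ρa) ∈ bs ×
                     (a , σa) ∈ cs × Δ ⊢ proj₂ d ∶ ρa ≍ σa)) ks
  kpart-sound [] = []
  kpart-sound ((a , ρa , σa , act , brL , brR , s) ∷ ks) =
    (a , ρa , σa , act , brL , brR , synth-sound s) ∷ kpart-sound ks

mainTheorem2 : (Γ : Ctx) (ρ σ : Contract) →
    WfCtx Γ → SessionContract ρ → SessionContract σ →
    (f : Orch) → Synth Γ ρ σ f → Γ ⊢ f ∶ ρ ≍ σ
mainTheorem2 _ _ _ _ _ _ _ f∈Synth = synth-sound f∈Synth
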